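{- Let $W = w_1 w_2 \cdots w_k$ and $x = x_1 x_2 \cdots x_m$ be words over an alphabet $\Sigma$ with $x \in CN(W,d)$, where $d > 0$. Let $A$ be the leftmost optimal alignment between $W$ and $x$, with $W$ in the first row and $x$ in the second row. If $w_j$ is the last character of $W$ that does not appear in a deletion column $\binom{w_t}{ - }$ of $A$, then (i) $w_j$ and $x_m$ form a match column $\binom{w_j}{x_m}$ of $A$, and (ii) there is no insertion column $\binom{ - }{x_{m-1}}$ before the column $\binom{w_j}{x_m}$ in $A$.
   Context: For words $U,V$ over $\Sigma$, $d_{lev}(U,V)$ is the Levenshtein distance (minimum number of single-character insertions, deletions and substitutions transforming $U$ into $V$). $N(W,d) = \{U : d_{lev}(U,W) \le d\}$ and $CN(W,d)$ is the set of words in $N(W,d)$ having no proper prefix in $N(W,d)$. An alignment is a two-row array whose rows are words over $\Sigma \cup \{ -\}$ ($-$ is a gap), with no column containing two gaps; removing gaps from the rows gives the two aligned words. Its cost is the number of columns whose entries differ; an optimal alignment has minimum cost (equal to the Levenshtein distance). A column $\binom{a}{b}$ is a match column if $a=b\in\Sigma$, a mismatch column if $a\ne b$ both in $\Sigma$, a deletion column if $b=-$, and an insertion column if $a=-$. Leftmost optimal alignment: let $A$ be an optimal alignment between two words with $k$ match/mismatch columns, at column indices $m_1 < m_2 < \cdots < m_k$. $A$ is the leftmost optimal alignment if, for any other optimal alignment $B$, $B$ has at least $k$ match/mismatch columns and the indices $p_1 < p_2 < \cdots$ of the match/mismatch columns of $B$ satisfy $m_i = p_i$ for $i \le j$ and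 $m_{j+1} < p_{j+1}$ for some $j \le k$. -}

module Defs where

open import Data.Nat using (ℕ; zero; suc; _≤_; _<_)
open import Data.List using (List; []; _∷_; _++_; length; take; drop)
open import Data.Product using (_×_; ∃-syntax)
open import Data.Empty using (⊥)
open import Relation.Nullary using (¬_; yes; no)
open import Relation.Binary.Definitions using (DecidableEquality)
open import Relation.Binary.PropositionalEquality using (_≡_; _≢_)

module _ {A : Set} where

  data Edit : List A → List A → Set where
    insertion    : ∀ u v a   → Edit (u ++ v) (u ++ a ∷ v)
    deletion     : ∀ u v a   → Edit (u ++ a ∷ v) (u ++ v)
    substitution : ∀ u v a b → Edit (u ++ a ∷ v) (u ++ b ∷ v)

  data EditSeq : ℕ → List A → List A → Set where
    done : ∀ {U} → EditSeq zero U U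
    step : ∀ {n U V Z} → Edit U V → EditSeq n V Z → EditSeq (suc n) U Z

  -- d_lev(U,V) ≤ d  (the minimum number of edits is ≤ d iff some
  -- edit sequence of length ≤ d exists)
  LevLe : List A → List A → ℕ → Set
  LevLe U V d = ∃[ n ] (n ≤ d × EditSeq n U V)

  InN : List A → ℕ → List A → Set
  InN W d U = LevLe U W d

  InCN : List A → ℕ → List A → Set
  InCN W d U = InN W d U × (∀ P Q → U ≡ P ++ Q → Q ≢ [] → ¬ InN W d P)

  data Column : Set where
    both : A → A → Column
    del  : A → Column
    ins  : A → Column

  data IsBoth : Column → Set where
    isBoth : ∀ a b → IsBoth (both a b)

  Alignment : Set
  Alignment = List Column

  top : Alignment → List A
  top []             = []
  top (both a b ∷ c) = a ∷ top c
  top (del a ∷ c)    = a ∷ top c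
  top (ins b ∷ c)    = top c

  bottom : Alignment → List A
  bottom []             = []
  bottom (both a b ∷ c) = b ∷ bottom c
  bottom (del a ∷ c)    = bottom c
  bottom (ins b ∷ c)    = b ∷ bottom c

  AlignmentOf : List A → List A → Alignment → Set
  AlignmentOf U V al = top al ≡ U × bottom al ≡ V

  module _ (_≟_ : DecidableEquality A) where

    cost : Alignment → ℕ
    cost []             = zero
    cost (both a b ∷ c) with a ≟ b
    ... | yes _ = cost c
    ... | no  _ = suc (cost c)
    cost (del a ∷ c)    = suc (cost c)
    cost (ins b ∷ c)    = suc (cost c)

    Optimal : List A → List A → Alignment → Set
    Optimal U V al =
      AlignmentOf U V al × (∀ B → AlignmentOf U V B → cost al ≤ cost B)

    bothIndices : ℕ → Alignment → List ℕ
    bothIndices i []             = []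
    bothIndices i (both a b ∷ c) = i ∷ bothIndices (suc i) c
    bothIndices i (del a ∷ c)    = bothIndices (suc i) c
    bothIndices i (ins b ∷ c)    = bothIndices (suc i) c

    -- HeadLt ms ps : for the (j+1)-st entries, m_{j+1} < p_{j+1}
    -- (given the lists after dropping the first j entries); when j = k
    -- (ms exhausted) there is nothing to compare.
    data HeadLt : List ℕ → List ℕ → Set where
      exhausted : ∀ {ps} → HeadLt [] ps
      lt        : ∀ {m p ms ps} → m < p → HeadLt (m ∷ ms) (p ∷ ps)

    LeftmostOptimal : List A → List A → Alignment → Set
    LeftmostOptimal U V al =
      Optimal U V al ×
      (∀ B → Optimal U V B →
        let ms = bothIndices 1 al
            ps = bothIndices 1 B
            k  = length ms
        in length ms ≤ length ps ×
           ∃[ j ] (j ≤ k × take j ms ≡ take j ps ×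
                   HeadLt (drop j ms) (drop j ps)))

{-# OPTIONS --safe #-}
module Submission where

-- Since x ∈ CN(W,d), an optimal alignment of W over x costs at most d, so the bottom row of
-- any alignment of W costing no more lies in N(W,d) and cannot be a proper prefix of x.
-- Each claim follows by producing such an alignment if it failed: insertion columns after
-- the last match/mismatch column can be dropped, a final mismatch column (a over b) can
-- become the deletion (a over -), and an insertion (- over x_{m-1}) followed only by
-- deletions before the final match (a over a) can be merged into it as (a over x_{m-1}).
-- Alignment costs bound edit distances in both directions; the harder direction uses that
-- composing alignments is subadditive in cost.

open import Defs
open import Data.Nat using (ℕ; suc; _<_; _+_; _≤_; z≤n; s≤s)
open import Data.Nat.Properties
  using (≤-refl; ≤-trans; ≤-reflexive; n≤1+n; m≤n⇒m≤1+n; m≤m+n; m≤n+m; +-mono-≤; +-monoʳ-≤;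
         +-suc; +-comm; suc-injective; +-commutativeSemigroup; module ≤-Reasoning)
open import Algebra.Properties.CommutativeSemigroup +-commutativeSemigroup using (interchange)
open import Data.List using (List; []; _∷_; _++_; length; map)
open import Data.List.Properties using (++-assoc; ∷-injective; ∷-injectiveʳ)
open import Data.List.Relation.Unary.All using (All; []; _∷_)
open import Data.Product using (_×_; ∃-syntax; _,_; proj₁; proj₂)
open import Data.Empty using (⊥)
open import Relation.Nullary using (¬_; yes; no; contradiction)
open import Relation.Binary.Definitions using (DecidableEquality)
open import Relation.Binary.PropositionalEquality

module _ {A : Set} where

  top-++ : ∀ (P Q : Alignment {A}) → top (P ++ Q) ≡ top P ++ top Q
  top-++ []             Q = refl
  top-++ (both a b ∷ P) Q = cong (a ∷_) (top-++ P Q)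
  top-++ (del a ∷ P)    Q = cong (a ∷_) (top-++ P Q)
  top-++ (ins b ∷ P)    Q = top-++ P Q

  bottom-++ : ∀ (P Q : Alignment {A}) → bottom (P ++ Q) ≡ bottom P ++ bottom Q
  bottom-++ []             Q = refl
  bottom-++ (both a b ∷ P) Q = cong (b ∷_) (bottom-++ P Q)
  bottom-++ (del a ∷ P)    Q = bottom-++ P Q
  bottom-++ (ins b ∷ P)    Q = cong (b ∷_) (bottom-++ P Q)

  matches : List A → Alignment {A}
  matches = map (λ a → both a a)

  top-matches : ∀ u → top (matches u) ≡ u
  top-matches []      = refl
  top-matches (a ∷ u) = cong (a ∷_) (top-matches u)

  bottom-matches : ∀ u → bottom (matches u) ≡ u
  bottom-matches []      = refl
  bottom-matches (a ∷ u) = cong (a ∷_) (bottom-matches u)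

  top-map-del : ∀ (u : List A) → top (map del u) ≡ u
  top-map-del []      = refl
  top-map-del (a ∷ u) = cong (a ∷_) (top-map-del u)

  bottom-map-del : ∀ (u : List A) → bottom (map del u) ≡ []
  bottom-map-del []      = refl
  bottom-map-del (a ∷ u) = bottom-map-del u

  -- Composition of an alignment of X over Y with one of Y over Z; the last
  -- clause only covers pairs whose middle rows disagree.
  _⨾_ : Alignment {A} → Alignment {A} → Alignment {A}
  (del a ∷ B)    ⨾ C              = del a ∷ (B ⨾ C)
  B              ⨾ (ins c ∷ C)    = ins c ∷ (B ⨾ C)
  (both a _ ∷ B) ⨾ (both _ c ∷ C) = both a c ∷ (B ⨾ C)
  (both a _ ∷ B) ⨾ (del _ ∷ C)    = del a ∷ (B ⨾ C)
  (ins _ ∷ B)    ⨾ (both _ c ∷ C) = ins c ∷ (B ⨾ C)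
  (ins _ ∷ B)    ⨾ (del _ ∷ C)    = B ⨾ C
  _              ⨾ _              = []

  ⨾-top : ∀ B C → bottom B ≡ top C → top (B ⨾ C) ≡ top B
  ⨾-top (del a ∷ B)    C              e = cong (a ∷_) (⨾-top B C e)
  ⨾-top []             (ins c ∷ C)    e = ⨾-top [] C e
  ⨾-top (both a b ∷ B) (ins c ∷ C)    e = ⨾-top (both a b ∷ B) C e
  ⨾-top (ins b ∷ B)    (ins c ∷ C)    e = ⨾-top (ins b ∷ B) C e
  ⨾-top (both a _ ∷ B) (both _ _ ∷ C) e = cong (a ∷_) (⨾-top B C (∷-injectiveʳ e))
  ⨾-top (both a _ ∷ B) (del _ ∷ C)    e = cong (a ∷_) (⨾-top B C (∷-injectiveʳ e))
  ⨾-top (ins _ ∷ B)    (both _ _ ∷ C) e = ⨾-top B C (∷-injectiveʳ e)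
  ⨾-top (ins _ ∷ B)    (del _ ∷ C)    e = ⨾-top B C (∷-injectiveʳ e)
  ⨾-top []             []             e = refl
  ⨾-top []             (both _ _ ∷ C) ()
  ⨾-top []             (del _ ∷ C)    ()
  ⨾-top (both _ _ ∷ B) []             ()
  ⨾-top (ins _ ∷ B)    []             ()

  ⨾-bottom : ∀ B C → bottom B ≡ top C → bottom (B ⨾ C) ≡ bottom C
  ⨾-bottom (del a ∷ B)    C              e = ⨾-bottom B C e
  ⨾-bottom []             (ins c ∷ C)    e = cong (c ∷_) (⨾-bottom [] C e)
  ⨾-bottom (both a b ∷ B) (ins c ∷ C)    e = cong (c ∷_) (⨾-bottom (both a b ∷ B) C e)
  ⨾-bottom (ins b ∷ B)    (ins c ∷ C)    e = cong (c ∷_) (⨾-bottom (ins b ∷ B) C e)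
  ⨾-bottom (both _ _ ∷ B) (both _ c ∷ C) e = cong (c ∷_) (⨾-bottom B C (∷-injectiveʳ e))
  ⨾-bottom (both _ _ ∷ B) (del _ ∷ C)    e = ⨾-bottom B C (∷-injectiveʳ e)
  ⨾-bottom (ins _ ∷ B)    (both _ c ∷ C) e = cong (c ∷_) (⨾-bottom B C (∷-injectiveʳ e))
  ⨾-bottom (ins _ ∷ B)    (del _ ∷ C)    e = ⨾-bottom B C (∷-injectiveʳ e)
  ⨾-bottom []             []             e = refl
  ⨾-bottom []             (both _ _ ∷ C) ()
  ⨾-bottom []             (del _ ∷ C)    ()
  ⨾-bottom (both _ _ ∷ B) []             ()
  ⨾-bottom (ins _ ∷ B)    []             ()

  edit-∷ : ∀ c {U V : List A} → Edit U V → Edit (c ∷ U) (c ∷ V)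
  edit-∷ c (insertion u v a)      = insertion (c ∷ u) v a
  edit-∷ c (deletion u v a)       = deletion (c ∷ u) v a
  edit-∷ c (substitution u v a b) = substitution (c ∷ u) v a b

  editSeq-∷ : ∀ c {n} {U V : List A} → EditSeq n U V → EditSeq n (c ∷ U) (c ∷ V)
  editSeq-∷ c done        = done
  editSeq-∷ c (step e es) = step (edit-∷ c e) (editSeq-∷ c es)

  middle≡[]-by-length : ∀ (u : List A) c v a →
    length u + 2 ≡ length ((u ++ c ∷ v) ++ a ∷ []) → v ≡ []
  middle≡[]-by-length []      c []          a _  = refl
  middle≡[]-by-length []      c (_ ∷ [])    a ()
  middle≡[]-by-length []      c (_ ∷ _ ∷ _) a ()
  middle≡[]-by-length (_ ∷ u) c v           a eq = middle≡[]-by-length u c v a (suc-injective eq)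

module _ {A : Set} (_≟_ : DecidableEquality A) where

  cost′ : Alignment {A} → ℕ
  cost′ = cost _≟_

  cost-++ : ∀ (P Q : Alignment {A}) → cost′ (P ++ Q) ≡ cost′ P + cost′ Q
  cost-++ []             Q = refl
  cost-++ (both a b ∷ P) Q with a ≟ b
  ... | yes _ = cost-++ P Q
  ... | no  _ = cong suc (cost-++ P Q)
  cost-++ (del a ∷ P)    Q = cong suc (cost-++ P Q)
  cost-++ (ins b ∷ P)    Q = cong suc (cost-++ P Q)

  cost-∷ : ∀ c (B : Alignment {A}) → cost′ (c ∷ B) ≡ cost′ (c ∷ []) + cost′ B
  cost-∷ c B = cost-++ (c ∷ []) B

  cost-∷≤ : ∀ c (B : Alignment {A}) → cost′ (c ∷ B) ≤ suc (cost′ B)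
  cost-∷≤ (both a b) B with a ≟ b
  ... | yes _ = n≤1+n _
  ... | no  _ = ≤-refl
  cost-∷≤ (del a)    B = ≤-refl
  cost-∷≤ (ins b)    B = ≤-refl

  cost-match : ∀ a (B : Alignment {A}) → cost′ (both a a ∷ B) ≡ cost′ B
  cost-match a B with a ≟ a
  ... | yes _   = refl
  ... | no  a≢a = contradiction refl a≢a

  cost-mismatch : ∀ {a b} (B : Alignment {A}) → a ≢ b → cost′ (both a b ∷ B) ≡ suc (cost′ B)
  cost-mismatch {a} {b} B a≢b with a ≟ b
  ... | yes a≡b = contradiction a≡b a≢b
  ... | no  _   = refl

  cost-both-triangle : ∀ a b c →
    cost′ (both a c ∷ []) ≤ cost′ (both a b ∷ []) + cost′ (both b c ∷ [])
  cost-both-triangle a b c with a ≟ c | a ≟ b | b ≟ c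
  ... | yes _   | _        | _     = z≤n
  ... | no  _   | no  _    | _     = s≤s z≤n
  ... | no  _   | yes _    | no  _ = s≤s z≤n
  ... | no  a≢c | yes refl | yes refl = contradiction refl a≢c

  suc-≤-+-suc : ∀ {m k} n → m ≤ n + k → suc m ≤ n + suc k
  suc-≤-+-suc {k = k} n m≤ = ≤-trans (s≤s m≤) (≤-reflexive (sym (+-suc n k)))

  cost-∷-subadditive : ∀ c c₁ c₂ (R B C : Alignment {A}) →
    cost′ (c ∷ []) ≤ cost′ (c₁ ∷ []) + cost′ (c₂ ∷ []) →
    cost′ R ≤ cost′ B + cost′ C →
    cost′ (c ∷ R) ≤ cost′ (c₁ ∷ B) + cost′ (c₂ ∷ C)
  cost-∷-subadditive c c₁ c₂ R B C c≤ R≤ = begin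
    cost′ (c ∷ R)                                   ≡⟨ cost-∷ c R ⟩
    cost′ (c ∷ []) + cost′ R                        ≤⟨ +-mono-≤ c≤ R≤ ⟩
    (cost′ (c₁ ∷ []) + cost′ (c₂ ∷ [])) + (cost′ B + cost′ C)
      ≡⟨ interchange (cost′ (c₁ ∷ [])) (cost′ (c₂ ∷ [])) (cost′ B) (cost′ C) ⟩
    (cost′ (c₁ ∷ []) + cost′ B) + (cost′ (c₂ ∷ []) + cost′ C)
      ≡⟨ sym (cong₂ _+_ (cost-∷ c₁ B) (cost-∷ c₂ C)) ⟩
    cost′ (c₁ ∷ B) + cost′ (c₂ ∷ C)                 ∎
    where open ≤-Reasoning

  ⨾-cost : ∀ B C → bottom B ≡ top C → cost′ (B ⨾ C) ≤ cost′ B + cost′ C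
  ⨾-cost (del a ∷ B)    C              e = s≤s (⨾-cost B C e)
  ⨾-cost []             (ins c ∷ C)    e = s≤s (⨾-cost [] C e)
  ⨾-cost (both a b ∷ B) (ins c ∷ C)    e =
    suc-≤-+-suc (cost′ (both a b ∷ B)) (⨾-cost (both a b ∷ B) C e)
  ⨾-cost (ins b ∷ B)    (ins c ∷ C)    e =
    suc-≤-+-suc (cost′ (ins b ∷ B)) (⨾-cost (ins b ∷ B) C e)
  ⨾-cost (both a b ∷ B) (both b′ c ∷ C) e with ∷-injective e
  ... | refl , e′ =
    cost-∷-subadditive (both a c) (both a b) (both b c) (B ⨾ C) B C (cost-both-triangle a b c) (⨾-cost B C e′)
  ⨾-cost (both a b ∷ B) (del _ ∷ C)    e =
    cost-∷-subadditive (del a) (both a b) (del b) (B ⨾ C) B C (m≤n+m 1 _) (⨾-cost B C (∷-injectiveʳ e))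
  ⨾-cost (ins b ∷ B)    (both b′ c ∷ C) e =
    cost-∷-subadditive (ins c) (ins b) (both b′ c) (B ⨾ C) B C (m≤m+n 1 _) (⨾-cost B C (∷-injectiveʳ e))
  ⨾-cost (ins _ ∷ B)    (del _ ∷ C)    e =
    ≤-trans (⨾-cost B C (∷-injectiveʳ e)) (+-mono-≤ (n≤1+n _) (n≤1+n _))
  ⨾-cost []             []             e = z≤n
  ⨾-cost []             (both _ _ ∷ C) e = z≤n
  ⨾-cost []             (del _ ∷ C)    e = z≤n
  ⨾-cost (both _ _ ∷ B) []             e = z≤n
  ⨾-cost (ins _ ∷ B)    []             e = z≤n

  cost-matches : ∀ u → cost′ (matches u) ≡ 0
  cost-matches []      = refl
  cost-matches (a ∷ u) = trans (cost-match a (matches u)) (cost-matches u)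

  AlignedWithin : List A → List A → ℕ → Set
  AlignedWithin U V n = ∃[ B ] (AlignmentOf U V B × cost′ B ≤ n)

  single-column : ∀ u v c →
    AlignedWithin (u ++ top (c ∷ []) ++ v) (u ++ bottom (c ∷ []) ++ v) 1
  single-column (a ∷ u) v c with single-column u v c
  ... | B , (top-B , bottom-B) , cost-B =
    both a a ∷ B , (cong (a ∷_) top-B , cong (a ∷_) bottom-B) ,
    ≤-trans (≤-reflexive (cost-match a B)) cost-B
  single-column []      v c =
    c ∷ matches v ,
    (trans (top-++ (c ∷ []) (matches v)) (cong (top (c ∷ []) ++_) (top-matches v)) ,
     trans (bottom-++ (c ∷ []) (matches v)) (cong (bottom (c ∷ []) ++_) (bottom-matches v))) ,
    ≤-trans (cost-∷≤ c (matches v)) (s≤s (≤-reflexive (cost-matches v)))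

  edit⇒alignedWithin : ∀ {U V} → Edit U V → AlignedWithin V U 1
  edit⇒alignedWithin (insertion u v a)      = single-column u v (del a)
  edit⇒alignedWithin (deletion u v a)       = single-column u v (ins a)
  edit⇒alignedWithin (substitution u v a b) = single-column u v (both b a)

  editSeq⇒alignedWithin : ∀ {n U V} → EditSeq n U V → AlignedWithin V U n
  editSeq⇒alignedWithin {U = U} done =
    matches U , (top-matches U , bottom-matches U) , ≤-reflexive (cost-matches U)
  editSeq⇒alignedWithin {suc n} (step e es)
    with editSeq⇒alignedWithin es | edit⇒alignedWithin e
  ... | B , (top-B , bottom-B) , cost-B | E , (top-E , bottom-E) , cost-E =
    B ⨾ E , (trans (⨾-top B E middle) top-B , trans (⨾-bottom B E middle) bottom-E) ,
    ≤-trans (⨾-cost B E middle) (≤-trans (+-mono-≤ cost-B cost-E) (≤-reflexive (+-comm n 1)))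
    where middle = trans bottom-B (sym top-E)

  alignment⇒editSeq : ∀ (B : Alignment {A}) → EditSeq (cost′ B) (bottom B) (top B)
  alignment⇒editSeq []             = done
  alignment⇒editSeq (both a b ∷ B) with a ≟ b
  ... | yes refl = editSeq-∷ a (alignment⇒editSeq B)
  ... | no  _    = step (substitution [] (bottom B) b a) (editSeq-∷ a (alignment⇒editSeq B))
  alignment⇒editSeq (del a ∷ B)    =
    step (insertion [] (bottom B) a) (editSeq-∷ a (alignment⇒editSeq B))
  alignment⇒editSeq (ins b ∷ B)    = step (deletion [] (bottom B) b) (alignment⇒editSeq B)

  optimal-cost≤ : ∀ {W U d al} → InN W d U → Optimal _≟_ W U al → cost′ al ≤ d
  optimal-cost≤ (n , n≤d , es) (_ , minimal) with editSeq⇒alignedWithin es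
  ... | B , B-aligns , cost-B = ≤-trans (minimal B B-aligns) (≤-trans cost-B n≤d)

  alignment⇒InN : ∀ {W d} (B : Alignment {A}) → top B ≡ W → cost′ B ≤ d → InN W d (bottom B)
  alignment⇒InN B top-B cost-B =
    cost′ B , cost-B , subst (EditSeq (cost′ B) (bottom B)) top-B (alignment⇒editSeq B)

  cost-map-del-top≤ : ∀ {S} → All (λ col → ¬ IsBoth col) S → cost′ (map del (top S)) ≤ cost′ S
  cost-map-del-top≤ []                         = z≤n
  cost-map-del-top≤ {both a b ∷ _} (¬both ∷ _) = contradiction (isBoth a b) ¬both
  cost-map-del-top≤ {del _ ∷ _}    (_ ∷ S)     = s≤s (cost-map-del-top≤ S)
  cost-map-del-top≤ {ins _ ∷ _}    (_ ∷ S)     = m≤n⇒m≤1+n (cost-map-del-top≤ S)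

  cost-merge-insertion : ∀ a c (R T : Alignment {A}) →
    cost′ (R ++ both a c ∷ T) ≤ cost′ (ins c ∷ R ++ both a a ∷ T)
  cost-merge-insertion a c R T = begin
    cost′ (R ++ both a c ∷ T)            ≡⟨ cost-++ R _ ⟩
    cost′ R + cost′ (both a c ∷ T)       ≤⟨ +-monoʳ-≤ (cost′ R) (cost-∷≤ (both a c) T) ⟩
    cost′ R + suc (cost′ T)              ≡⟨ +-suc (cost′ R) _ ⟩
    suc (cost′ R + cost′ T)              ≡⟨ cong (λ k → suc (cost′ R + k)) (cost-match a T) ⟨
    suc (cost′ R + cost′ (both a a ∷ T)) ≡⟨ cong suc (cost-++ R _) ⟨
    cost′ (ins c ∷ R ++ both a a ∷ T)    ∎
    where open ≤-Reasoning

  module Closest {W x : List A} {d : ℕ} (x∈CN : InCN W d x) where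

    cheaper-segment⇒remainder≡[] : ∀ {al} → Optimal _≟_ W x al →
      ∀ P S S′ Q → al ≡ P ++ S → top S′ ≡ top S → cost′ S′ ≤ cost′ S →
      bottom S ≡ bottom S′ ++ Q → Q ≡ []
    cheaper-segment⇒remainder≡[] opt P S S′ []      al≡ top-S′ cost-S′ bottom-S = refl
    cheaper-segment⇒remainder≡[] opt P S S′ (q ∷ Q) refl top-S′ cost-S′ bottom-S =
      contradiction (alignment⇒InN (P ++ S′) top-D cost-D) (proj₂ x∈CN _ (q ∷ Q) x≡ λ ())
      where
      top-D : top (P ++ S′) ≡ W
      top-D = begin
        top (P ++ S′)     ≡⟨ top-++ P S′ ⟩
        top P ++ top S′   ≡⟨ cong (top P ++_) top-S′ ⟩
        top P ++ top S    ≡⟨ top-++ P S ⟨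
        top (P ++ S)      ≡⟨ proj₁ (proj₁ opt) ⟩
        W                 ∎
        where open ≡-Reasoning
      cost-D : cost′ (P ++ S′) ≤ d
      cost-D = begin
        cost′ (P ++ S′)       ≡⟨ cost-++ P S′ ⟩
        cost′ P + cost′ S′    ≤⟨ +-monoʳ-≤ (cost′ P) cost-S′ ⟩
        cost′ P + cost′ S     ≡⟨ cost-++ P S ⟨
        cost′ (P ++ S)        ≤⟨ optimal-cost≤ {al = P ++ S} (proj₁ x∈CN) opt ⟩
        d                     ∎
        where open ≤-Reasoning
      x≡ : x ≡ bottom (P ++ S′) ++ q ∷ Q
      x≡ = begin
        x                                ≡⟨ proj₂ (proj₁ opt) ⟨
        bottom (P ++ S)                  ≡⟨ bottom-++ P S ⟩
        bottom P ++ bottom S             ≡⟨ cong (bottom P ++_) bottom-S ⟩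
        bottom P ++ bottom S′ ++ q ∷ Q   ≡⟨ ++-assoc (bottom P) (bottom S′) _ ⟨
        (bottom P ++ bottom S′) ++ q ∷ Q ≡⟨ cong (_++ q ∷ Q) (bottom-++ P S′) ⟨
        bottom (P ++ S′) ++ q ∷ Q        ∎
        where open ≡-Reasoning

    suffix-bottom≡[] : ∀ {al pre suf a b} → Optimal _≟_ W x al →
      al ≡ pre ++ both a b ∷ suf → All (λ col → ¬ IsBoth col) suf → bottom suf ≡ []
    suffix-bottom≡[] {pre = pre} {suf} {a} {b} opt al≡ no-match =
      cheaper-segment⇒remainder≡[] opt (pre ++ both a b ∷ []) suf (map del (top suf)) (bottom suf)
        (trans al≡ (sym (++-assoc pre _ suf)))
        (top-map-del (top suf))
        (cost-map-del-top≤ no-match)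
        (cong (_++ bottom suf) (sym (bottom-map-del (top suf))))

    last-column-match : ∀ {al pre suf a b} → Optimal _≟_ W x al →
      al ≡ pre ++ both a b ∷ suf → bottom suf ≡ [] → a ≡ b
    last-column-match {pre = pre} {suf} {a} {b} opt al≡ bottom-suf with a ≟ b
    ... | yes a≡b = a≡b
    ... | no  a≢b =
      contradiction
        (cheaper-segment⇒remainder≡[] opt pre (both a b ∷ suf) (del a ∷ suf) (b ∷ [])
          al≡ refl (≤-reflexive (sym (cost-mismatch suf a≢b)))
          (trans (cong (b ∷_) bottom-suf) (cong (_++ b ∷ []) (sym bottom-suf))))
        λ ()

    no-insertion-before-last-match : ∀ {al pre₁ pre₂ suf a c} → Optimal _≟_ W x al →
      al ≡ (pre₁ ++ ins c ∷ pre₂) ++ both a a ∷ suf →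
      bottom pre₂ ≡ [] → bottom suf ≡ [] → ⊥
    no-insertion-before-last-match {pre₁ = pre₁} {pre₂} {suf} {a} {c} opt al≡ bottom-pre₂ bottom-suf =
      contradiction
        (cheaper-segment⇒remainder≡[] opt pre₁
          (ins c ∷ pre₂ ++ both a a ∷ suf) (pre₂ ++ both a c ∷ suf) (a ∷ [])
          (trans al≡ (++-assoc pre₁ (ins c ∷ pre₂) _))
          (trans (top-++ pre₂ _) (sym (top-++ pre₂ _)))
          (cost-merge-insertion a c pre₂ suf)
          bottom-shrinks)
        λ ()
      where
      bottom-shrinks : c ∷ bottom (pre₂ ++ both a a ∷ suf) ≡ bottom (pre₂ ++ both a c ∷ suf) ++ a ∷ []
      bottom-shrinks rewrite bottom-++ pre₂ (both a a ∷ suf) | bottom-++ pre₂ (both a c ∷ suf)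
                           | bottom-pre₂ | bottom-suf = refl

lemma1 : {A : Set} (_≟_ : DecidableEquality A)
    (W x : List A) (d : ℕ) → 0 < d → InCN W d x →
    (al : Alignment) → LeftmostOptimal _≟_ W x al →
    (pre suf : Alignment) (a b : A) →
    al ≡ pre ++ both a b ∷ suf →
    All (λ col → ¬ IsBoth col) suf →
    (a ≡ b × x ≡ bottom pre ++ b ∷ [])
    × ¬ (∃[ pre₁ ] ∃[ pre₂ ] ∃[ c ]
          (pre ≡ pre₁ ++ ins c ∷ pre₂ × length (bottom pre₁) + 2 ≡ length x))
lemma1 _≟_ W x d _ x∈CN al (opt , _) pre suf a b al≡ no-match = (a≡b , x≡) , no-insertion
  where
  open Closest _≟_ x∈CN

  bottom-suf : bottom suf ≡ []
  bottom-suf = suffix-bottom≡[] opt al≡ no-match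

  a≡b : a ≡ b
  a≡b = last-column-match opt al≡ bottom-suf

  x≡ : x ≡ bottom pre ++ b ∷ []
  x≡ = begin
    x                             ≡⟨ proj₂ (proj₁ opt) ⟨
    bottom al                     ≡⟨ cong bottom al≡ ⟩
    bottom (pre ++ both a b ∷ suf) ≡⟨ bottom-++ pre _ ⟩
    bottom pre ++ b ∷ bottom suf  ≡⟨ cong (λ s → bottom pre ++ b ∷ s) bottom-suf ⟩
    bottom pre ++ b ∷ []          ∎
    where open ≡-Reasoning

  no-insertion : ¬ (∃[ pre₁ ] ∃[ pre₂ ] ∃[ c ]
    (pre ≡ pre₁ ++ ins c ∷ pre₂ × length (bottom pre₁) + 2 ≡ length x))
  no-insertion (pre₁ , pre₂ , c , pre≡ , |x|≡) =
    no-insertion-before-last-match opt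
      (trans al≡ (cong₂ (λ p z → p ++ both a z ∷ suf) pre≡ (sym a≡b))) bottom-pre₂ bottom-suf
    where
    x-split : x ≡ (bottom pre₁ ++ c ∷ bottom pre₂) ++ b ∷ []
    x-split = trans x≡ (cong (_++ b ∷ []) (trans (cong bottom pre≡) (bottom-++ pre₁ _)))
    bottom-pre₂ : bottom pre₂ ≡ []
    bottom-pre₂ = middle≡[]-by-length (bottom pre₁) c (bottom pre₂) b (trans |x|≡ (cong length x-split))
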